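{- Let $G$ be a connected $C_4$-free graph of order $n$ and minimum degree $\delta$, let $v_0$ be a centre vertex of $G$ with eccentricity $r$ (the radius of $G$), and let $X(v_0)=(n_0,n_1,\ldots,n_r)$ be its distance degree. Then, with $\delta^*=\delta^2-2\lfloor\delta/2\rfloor+1$: (D1) $n_0=1$; (D2) $\sum_{i=0}^\infty n_i=n$; (D3) $n_i\ge2$ for all $i\in\{1,\ldots,r-1\}$; (D4) for all $i\in\{0,1,\ldots,r\}$ with $i\equiv0\pmod5$, $n_{i-2}+n_{i-1}+n_i+n_{i+1}+n_{i+2}\ge\delta^*$; (D5) for all $i\in\{10,11,\ldots,r-9\}$ with $i\equiv0\pmod5$, $n_{i-2}+n_{i-1}+n_i+n_{i+1}+n_{i+2}\ge2\delta^*$.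
   Context: $C_4$-free means no 4-cycle as a subgraph. A centre vertex is a vertex of minimum eccentricity. $n_i$ is the number of vertices at distance exactly $i$ from $v_0$, with $n_i=0$ for $i<0$ or $i>r$. -}

module Defs where

open import Data.Nat using (ℕ; zero; suc; _+_; _*_; _∸_; _≤_)
open import Data.Nat.DivMod using (_/_)
open import Data.Integer using (ℤ; +_; -[1+_])
open import Data.Bool using (Bool; true; false; _∨_; _∧_; if_then_else_; not)
open import Data.Fin using (Fin; zero; suc)
open import Data.Fin.Properties using () renaming (_≟_ to _≟ᶠ_)
open import Data.Product using (Σ; _×_; ∃)
open import Relation.Nullary using (¬_)
open import Relation.Nullary.Decidable using (⌊_⌋)
open import Relation.Binary.PropositionalEquality using (_≡_; _≢_)

record Graph (n : ℕ) : Set where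
  field
    adj    : Fin n → Fin n → Bool
    sym    : ∀ u v → adj u v ≡ adj v u
    irrefl : ∀ v → adj v v ≡ false
open Graph public

count : ∀ {n} → (Fin n → Bool) → ℕ
count {zero}  p = 0
count {suc n} p = (if p zero then 1 else 0) + count (λ i → p (suc i))

anyFin : ∀ {n} → (Fin n → Bool) → Bool
anyFin {zero}  p = false
anyFin {suc n} p = p zero ∨ anyFin (λ i → p (suc i))

degree : ∀ {n} → Graph n → Fin n → ℕ
degree G v = count (adj G v)

IsMinDegree : ∀ {n} → Graph n → ℕ → Set
IsMinDegree G δ = (∀ v → δ ≤ degree G v) × ∃ λ v → degree G v ≡ δ

-- reach G k u v = true iff there is a walk from u to v of length at most k,
-- i.e. dist(u,v) ≤ k.
reach : ∀ {n} → Graph n → ℕ → Fin n → Fin n → Bool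
reach G zero    u v = ⌊ u ≟ᶠ v ⌋
reach G (suc k) u v = reach G k u v ∨ anyFin (λ w → reach G k u w ∧ adj G w v)

atDist : ∀ {n} → Graph n → Fin n → ℕ → Fin n → Bool
atDist G u zero    v = reach G zero u v
atDist G u (suc k) v = reach G (suc k) u v ∧ not (reach G k u v)

Connected : ∀ {n} → Graph n → Set
Connected G = ∀ u v → ∃ λ k → reach G k u v ≡ true

IsEccentricity : ∀ {n} → Graph n → Fin n → ℕ → Set
IsEccentricity G v r =
  (∀ u → reach G r v u ≡ true) ×
  (∀ k → (∀ u → reach G k v u ≡ true) → r ≤ k)

IsCentre : ∀ {n} → Graph n → Fin n → ℕ → Set
IsCentre G v r = IsEccentricity G v r × (∀ u s → IsEccentricity G u s → r ≤ s)

C4Free : ∀ {n} → Graph n → Set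
C4Free G = ∀ a b c d → a ≢ b → a ≢ c → a ≢ d → b ≢ c → b ≢ d → c ≢ d →
  ¬ (adj G a b ≡ true × adj G b c ≡ true × adj G c d ≡ true × adj G d a ≡ true)

distDeg : ∀ {n} → Graph n → Fin n → ℕ → ℕ
distDeg G v i = count (atDist G v i)

distDegℤ : ∀ {n} → Graph n → Fin n → ℤ → ℕ
distDegℤ G v (+ i)     = distDeg G v i
distDegℤ G v -[1+ _ ]  = 0

sumTo : (ℕ → ℕ) → ℕ → ℕ
sumTo f zero    = f zero
sumTo f (suc m) = sumTo f m + f (suc m)

window5 : ∀ {n} → Graph n → Fin n → ℕ → ℕ
window5 G v i = N (+ i Data.Integer.- + 2) + N (+ i Data.Integer.- + 1) + N (+ i)
              + N (+ (i + 1)) + N (+ (i + 2))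
  where N = distDegℤ G v

deltaStar : ℕ → ℕ
deltaStar δ = δ * δ ∸ 2 * (δ / 2) + 1

-- In a C₄-free graph of minimum degree δ every ball of radius 2 has at least δ* vertices.
-- A neighbour w of u has at most one neighbour inside N(u), since two would close a 4-cycle
-- through u; so the edges inside N(u) form a matching, whose number P of ordered pairs is even
-- and at most d = deg u. The neighbours of w other than u and its partner lie at distance 2
-- from u, and each vertex at distance 2 is adjacent to only one vertex of N(u). Hence
-- |B₂(u)| ≥ 1 + dδ − P, which is at least δ* because P ≤ 2⌊δ/2⌋ when d = δ.
--
-- The ball of radius 2 around a vertex of layer i lies in the layers i−2, …, i+2, which gives
-- (D4). For (D3) and (D5): if a vertex z of layer 1 (resp. 5) reached all of layer i within
-- i − 1 steps, as it does when layer i is a single vertex (resp. lies within distance 4 of one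
-- of its vertices), then z would have eccentricity at most r − 1, against the choice of v₀.
-- Otherwise layer i has two vertices, resp. two vertices at distance more than 4, and the balls
-- of radius 2 around these are disjoint.

module Submission where

open import Defs hiding (sym)
open import Data.Nat
  using (ℕ; zero; suc; _+_; _*_; _∸_; _≤_; _<_; _≤?_; z≤n; s≤s; s≤s⁻¹; pred; >-nonZero)
open import Data.Nat.Properties
  using (module ≤-Reasoning; +-*-semiring; ≤-refl; ≤-trans; ≤-reflexive; +-identityʳ;
        +-mono-≤; +-suc; +-monoʳ-≤; n≤1+n; +-assoc; m≤m+n; +-comm; *-suc; *-monoʳ-≤;
        +-cancelˡ-≤; *-monoˡ-≤; +-monoˡ-≤; ≰⇒>; m+n≤o⇒m≤o; ≤-antisym; m≤n+o⇒m∸n≤o;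
        m≤n⇒m<n∨m≡n; m≤n⇒m≤1+n; 1+n≰n; m+[n∸m]≡n; m+n≤o⇒n≤o; suc[m]≤n⇒m≤pred[n];
        m≤n⇒∃[o]m+o≡n; m≤pred[n]⇒suc[m]≤n)
open import Data.Nat.DivMod using (_/_; _%_; m*[n/m]≡n; /-monoˡ-≤; m≥n⇒m/n>0)
open import Data.Nat.Divisibility using (_∣_; _∣0; m∣m*n; ∣m∣n⇒∣m+n)
open import Data.Nat.Tactic.RingSolver using (solve-∀)
open import Data.Integer as ℤ using (ℤ; -[1+_]; _⊖_)
open import Data.Integer.Properties using (m-n≡m⊖n; +-cancelˡ-⊖)
open import Data.Bool using (Bool; true; false; _∨_; _∧_; not; if_then_else_)
open import Data.Bool.Properties
  using (∨-zeroʳ; ∧-identityʳ; ∧-comm; ∧-zeroʳ; not-injective)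
  renaming (_≟_ to _≟ᵇ_)
open import Data.Fin using (Fin; zero; suc)
open import Data.Fin.Properties using (_≟_; suc-injective; all?; any?; ¬∀⟶∃¬)
open import Data.Product using (∃; _×_; _,_; proj₁; proj₂)
open import Data.Sum using (_⊎_; inj₁; inj₂)
open import Data.Empty using (⊥; ⊥-elim)
open import Function using (_∘_)
open import Relation.Nullary using (¬_; Dec; yes; no; contradiction; ¬?)
open import Relation.Nullary.Decidable
  using (⌊_⌋; map′; isYes≗does; dec-true; _×-dec_; decidable-stable)
open import Relation.Binary.PropositionalEquality
open import Algebra.Properties.Semiring.Sum +-*-semiring
  using (sum-syntax; sum-cong-≗; ∑-distrib-+; ∑-comm; *-distribʳ-sum)

χ : Bool → ℕ
χ b = if b then 1 else 0

χ-mono : ∀ {a b} → (a ≡ true → b ≡ true) → χ a ≤ χ b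
χ-mono {false} _ = z≤n
χ-mono {true}  h rewrite h refl = ≤-refl

χ*≤χ+ : ∀ b {m k} → (b ≡ true → m ≤ 1 + k) → χ b * m ≤ χ b + k
χ*≤χ+ false _ = z≤n
χ*≤χ+ true {m} h = ≤-trans (≤-reflexive (+-identityʳ m)) (h refl)

∧-true⁻ : ∀ {a b} → a ∧ b ≡ true → a ≡ true × b ≡ true
∧-true⁻ {true} e = refl , e

∨-introˡ : ∀ {a} b → a ≡ true → a ∨ b ≡ true
∨-introˡ _ refl = refl

∨-introʳ : ∀ a {b} → b ≡ true → a ∨ b ≡ true
∨-introʳ a refl = ∨-zeroʳ a

∨-true⁻ : ∀ {a b} → a ∨ b ≡ true → a ≡ true ⊎ b ≡ true
∨-true⁻ {true}  _ = inj₁ refl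
∨-true⁻ {false} e = inj₂ e

private
  variable
    n : ℕ

Unique : (Fin n → Bool) → Set
Unique p = ∀ a b → p a ≡ true → p b ≡ true → a ≡ b

count≡∑ : (p : Fin n → Bool) → count p ≡ ∑[ i < n ] χ (p i)
count≡∑ {zero}  p = refl
count≡∑ {suc n} p = cong (χ (p zero) +_) (count≡∑ (p ∘ suc))

count-cong : {p q : Fin n → Bool} → (∀ i → p i ≡ q i) → count p ≡ count q
count-cong {zero}  e = refl
count-cong {suc n} e = cong₂ _+_ (cong χ (e zero)) (count-cong (e ∘ suc))

count-mono : {p q : Fin n → Bool} → (∀ i → p i ≡ true → q i ≡ true) → count p ≤ count q
count-mono {zero}  h = z≤n
count-mono {suc n} h = +-mono-≤ (χ-mono (h zero)) (count-mono (h ∘ suc))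

count-all-false : {p : Fin n → Bool} → (∀ i → p i ≡ false) → count p ≡ 0
count-all-false {zero}      h = refl
count-all-false {suc n} {p} h rewrite h zero = count-all-false (h ∘ suc)

count-all-true : {p : Fin n → Bool} → (∀ i → p i ≡ true) → count p ≡ n
count-all-true {zero}      h = refl
count-all-true {suc n} {p} h rewrite h zero = cong suc (count-all-true (h ∘ suc))

count-∨-≤ : (p q : Fin n → Bool) → count (λ i → p i ∨ q i) ≤ count p + count q
count-∨-≤ {zero}  p q = z≤n
count-∨-≤ {suc n} p q with p zero | q zero | count-∨-≤ (p ∘ suc) (q ∘ suc)
... | false | false | ih = ih
... | false | true  | ih = ≤-trans (s≤s ih) (≤-reflexive (sym (+-suc _ _)))
... | true  | false | ih = s≤s ih
... | true  | true  | ih = s≤s (≤-trans ih (+-monoʳ-≤ _ (n≤1+n _)))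

count-∨-disjoint : (p q : Fin n → Bool) → (∀ i → p i ≡ true → q i ≡ true → ⊥) →
                   count (λ i → p i ∨ q i) ≡ count p + count q
count-∨-disjoint {zero}  p q _ = refl
count-∨-disjoint {suc n} p q disj
  with p zero in ep | q zero in eq | count-∨-disjoint (p ∘ suc) (q ∘ suc) (disj ∘ suc)
... | false | false | ih = ih
... | false | true  | ih = trans (cong suc ih) (sym (+-suc _ _))
... | true  | false | ih = cong suc ih
... | true  | true  | _  = ⊥-elim (disj zero ep eq)

count-≤-χ-any : (p : Fin n → Bool) → Unique p → count p ≤ χ (anyFin p)
count-≤-χ-any {zero}  p _ = z≤n
count-≤-χ-any {suc n} p u with p zero in e
... | true  = ≤-reflexive (cong suc (count-all-false rest-false))
  where
  rest-false : ∀ i → p (suc i) ≡ false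
  rest-false i with p (suc i) in e′
  ... | false = refl
  ... | true  with () ← u (suc i) zero e′ e
... | false = count-≤-χ-any (p ∘ suc) (λ a b pa pb → suc-injective (u (suc a) (suc b) pa pb))

anyFin-intro : (p : Fin n → Bool) (a : Fin n) → p a ≡ true → anyFin p ≡ true
anyFin-intro p zero    e rewrite e = refl
anyFin-intro p (suc a) e rewrite anyFin-intro (p ∘ suc) a e = ∨-zeroʳ (p zero)

anyFin-elim : (p : Fin n → Bool) → anyFin p ≡ true → ∃ λ a → p a ≡ true
anyFin-elim {suc n} p e with p zero in e₀
... | true  = zero , e₀
... | false with anyFin-elim (p ∘ suc) e
...   | a , pa = suc a , pa

⌊≟⌋⇒≡ : {a b : Fin n} → ⌊ a ≟ b ⌋ ≡ true → a ≡ b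
⌊≟⌋⇒≡ {a = a} {b} e with a ≟ b | e
... | yes a≡b | _ = a≡b

⌊≟⌋-refl : (a : Fin n) → ⌊ a ≟ a ⌋ ≡ true
⌊≟⌋-refl a = trans (isYes≗does (a ≟ a)) (dec-true (a ≟ a) refl)

⌊≟⌋⇒≢ : {a b : Fin n} → ⌊ a ≟ b ⌋ ≡ false → a ≢ b
⌊≟⌋⇒≢ {a = a} e refl = contradiction (trans (sym (⌊≟⌋-refl a)) e) λ ()

-- ⌊ suc v ≟ suc i ⌋ does not reduce to ⌊ v ≟ i ⌋: ⌊_⌋ is stuck on the neutral does-field of map′.
count-singleton : (v : Fin n) → count (λ x → ⌊ v ≟ x ⌋) ≡ 1
count-singleton {suc n} zero    = cong suc (count-all-false {n} (λ _ → refl))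
count-singleton {suc n} (suc v) =
  trans (count-cong (λ i → trans (isYes≗does (suc v ≟ suc i)) (sym (isYes≗does (v ≟ i)))))
        (count-singleton v)

count-pair : (p : Fin n → Bool) {a b : Fin n} → a ≢ b → p a ≡ true → p b ≡ true → 2 ≤ count p
count-pair p {a} {b} a≢b pa pb = begin
  2                                                 ≡⟨ cong₂ _+_ (count-singleton a) (count-singleton b) ⟨
  count (λ x → ⌊ a ≟ x ⌋) + count (λ x → ⌊ b ≟ x ⌋) ≡⟨ count-∨-disjoint _ _ distinct ⟨
  count (λ x → ⌊ a ≟ x ⌋ ∨ ⌊ b ≟ x ⌋)               ≤⟨ count-mono covered ⟩
  count p                                           ∎
  where
  open ≤-Reasoning
  distinct : ∀ x → ⌊ a ≟ x ⌋ ≡ true → ⌊ b ≟ x ⌋ ≡ true → ⊥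
  distinct x ax bx = a≢b (trans (⌊≟⌋⇒≡ ax) (sym (⌊≟⌋⇒≡ bx)))
  covered : ∀ x → ⌊ a ≟ x ⌋ ∨ ⌊ b ≟ x ⌋ ≡ true → p x ≡ true
  covered x h with ∨-true⁻ {⌊ a ≟ x ⌋} h
  ... | inj₁ ax = subst (λ y → p y ≡ true) (⌊≟⌋⇒≡ ax) pa
  ... | inj₂ bx = subst (λ y → p y ≡ true) (⌊≟⌋⇒≡ bx) pb

∑-mono-≤ : {f g : Fin n → ℕ} → (∀ i → f i ≤ g i) → ∑[ i < n ] f i ≤ ∑[ i < n ] g i
∑-mono-≤ {zero}  h = z≤n
∑-mono-≤ {suc n} h = +-mono-≤ (h zero) (∑-mono-≤ (h ∘ suc))

handshake : (A : Fin n → Fin n → ℕ) → (∀ i j → A i j ≡ A j i) → (∀ i → A i i ≡ 0) →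
            2 ∣ ∑[ i < n ] ∑[ j < n ] A i j
handshake {zero}  A _ _ = 2 ∣0
handshake {suc n} A symm diag = subst (2 ∣_) (sym split) (∣m∣n⇒∣m+n (m∣m*n row) 2∣rest)
  where
  row = ∑[ j < n ] A zero (suc j)
  rest = ∑[ i < n ] ∑[ j < n ] A (suc i) (suc j)
  2∣rest : 2 ∣ rest
  2∣rest = handshake (λ i j → A (suc i) (suc j)) (λ i j → symm (suc i) (suc j)) (diag ∘ suc)
  split : ∑[ i < suc n ] ∑[ j < suc n ] A i j ≡ 2 * row + rest
  split = begin
    (A zero zero + row) + ∑[ i < n ] (A (suc i) zero + ∑[ j < n ] A (suc i) (suc j))
      ≡⟨ cong₂ _+_ (cong (_+ row) (diag zero)) (∑-distrib-+ (λ i → A (suc i) zero) _) ⟩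
    row + (∑[ i < n ] A (suc i) zero + rest)
      ≡⟨ cong (λ c → row + (c + rest)) (sum-cong-≗ (λ i → symm (suc i) zero)) ⟩
    row + (row + rest)
      ≡⟨ +-assoc row row rest ⟨
    row + row + rest
      ≡⟨ cong (λ c → row + c + rest) (+-identityʳ row) ⟨
    2 * row + rest ∎
    where open ≡-Reasoning

square-≤-of-large-degree : ∀ {δ d B} → suc δ ≤ d → d ≤ B → d * δ ≤ B + d →
                           δ * δ ≤ B + 2 * (δ / 2)
square-≤-of-large-degree {zero}                _     _   _ = z≤n
square-≤-of-large-degree {suc zero}    {B = B} 2≤d   d≤B _ =
  ≤-trans (≤-trans (s≤s z≤n) 2≤d) (≤-trans d≤B (m≤m+n B _))
square-≤-of-large-degree {suc (suc e)} {d} {B} 3+e≤d _ dδ≤B+d = begin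
  suc (suc e) * suc (suc e) ≡⟨ square-expand e ⟩
  1 + (3 + e) * suc e       ≤⟨ s≤s (*-monoˡ-≤ (suc e) 3+e≤d) ⟩
  1 + d * suc e             ≤⟨ s≤s (+-cancelˡ-≤ d _ _ d+d[1+e]≤d+B) ⟩
  1 + B                     ≡⟨ +-comm 1 B ⟩
  B + 1                     ≤⟨ +-monoʳ-≤ B (≤-trans (n≤1+n 1) (*-monoʳ-≤ 2 1≤δ/2)) ⟩
  B + 2 * (suc (suc e) / 2) ∎
  where
  open ≤-Reasoning
  square-expand : ∀ e → suc (suc e) * suc (suc e) ≡ 1 + (3 + e) * suc e
  square-expand = solve-∀
  1≤δ/2 : 1 ≤ suc (suc e) / 2
  1≤δ/2 = m≥n⇒m/n>0 {suc (suc e)} (s≤s (s≤s z≤n))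
  d+d[1+e]≤d+B : d + d * suc e ≤ d + B
  d+d[1+e]≤d+B = begin
    d + d * suc e     ≡⟨ *-suc d (suc e) ⟨
    d * suc (suc e)   ≤⟨ dδ≤B+d ⟩
    B + d             ≡⟨ +-comm B d ⟩
    d + B             ∎

-- If d = δ, parity gives P ≤ 2⌊δ/2⌋; if d > δ, already dδ − d ≥ (δ + 1)(δ − 1) = δ² − 1.
deltaStar-≤ : ∀ {δ d P S B} → δ ≤ d → P ≤ d → 2 ∣ P →
              d * δ ≤ d + (P + S) → suc (d + S) ≤ B → deltaStar δ ≤ B
deltaStar-≤ {δ} {d} {P} {S} {suc B} δ≤d P≤d 2∣P dδ≤d+P+S (s≤s d+S≤B) =
  ≤-trans (≤-reflexive (+-comm _ 1))
          (s≤s (m≤n+o⇒m∸n≤o (δ * δ) (2 * (δ / 2))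
                 (≤-trans square-≤ (≤-reflexive (+-comm B _)))))
  where
  open ≤-Reasoning

  rearrange : ∀ a b c → a + (b + c) ≡ a + c + b
  rearrange = solve-∀

  dδ≤B+P : d * δ ≤ B + P
  dδ≤B+P = begin
    d * δ       ≤⟨ dδ≤d+P+S ⟩
    d + (P + S) ≡⟨ rearrange d P S ⟩
    d + S + P   ≤⟨ +-monoˡ-≤ P d+S≤B ⟩
    B + P       ∎

  square-≤ : δ * δ ≤ B + 2 * (δ / 2)
  square-≤ with d ≤? δ
  ... | no d≰δ  = square-≤-of-large-degree (≰⇒> d≰δ) (m+n≤o⇒m≤o d d+S≤B)
                    (≤-trans dδ≤B+P (+-monoʳ-≤ B P≤d))
  ... | yes d≤δ = begin
    δ * δ           ≡⟨ cong (_* δ) (≤-antisym δ≤d d≤δ) ⟩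
    d * δ           ≤⟨ dδ≤B+P ⟩
    B + P           ≡⟨ cong (B +_) (m*[n/m]≡n 2∣P) ⟨
    B + 2 * (P / 2) ≤⟨ +-monoʳ-≤ B (*-monoʳ-≤ 2 (/-monoˡ-≤ 2 (≤-trans P≤d d≤δ))) ⟩
    B + 2 * (δ / 2) ∎

module Reachability {n : ℕ} (G : Graph n) where

  record Within (k : ℕ) (u v : Fin n) : Set where
    constructor within
    field reached : reach G k u v ≡ true
  open Within public

  within? : ∀ k u v → Dec (Within k u v)
  within? k u v = map′ within reached (reach G k u v ≟ᵇ true)

  within-refl : ∀ u → Within 0 u u
  within-refl u = within (⌊≟⌋-refl u)

  within-0⇒≡ : ∀ {u v} → Within 0 u v → u ≡ v
  within-0⇒≡ (within e) = ⌊≟⌋⇒≡ e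

  within-suc : ∀ {k u v} → Within k u v → Within (suc k) u v
  within-suc {k} {u} {v} (within e) = within (∨-introˡ (anyFin (λ w → reach G k u w ∧ adj G w v)) e)

  within-snoc : ∀ {k u w v} → Within k u w → adj G w v ≡ true → Within (suc k) u v
  within-snoc {k} {u} {w} {v} (within e) wv =
    within (∨-introʳ (reach G k u v)
              (anyFin-intro (λ x → reach G k u x ∧ adj G x v) w (cong₂ _∧_ e wv)))

  within-suc⁻ : ∀ {k u v} → Within (suc k) u v →
                Within k u v ⊎ ∃ λ w → Within k u w × adj G w v ≡ true
  within-suc⁻ {k} {u} {v} (within e) with ∨-true⁻ {reach G k u v} e
  ... | inj₁ e′ = inj₁ (within e′)
  ... | inj₂ e′ with anyFin-elim (λ w → reach G k u w ∧ adj G w v) e′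
  ...   | w , uwv = let uw , wv = ∧-true⁻ {reach G k u w} uwv in inj₂ (w , within uw , wv)

  within-adj : ∀ {u v} → adj G u v ≡ true → Within 1 u v
  within-adj {u} = within-snoc (within-refl u)

  within-mono : ∀ {k l u v} → k ≤ l → Within k u v → Within l u v
  within-mono {l = zero}  z≤n h = h
  within-mono {l = suc l} k≤1+l h with m≤n⇒m<n∨m≡n k≤1+l
  ... | inj₁ k<1+l = within-suc (within-mono (s≤s⁻¹ k<1+l) h)
  ... | inj₂ refl  = h

  within-trans : ∀ {a b u w v} → Within a u w → Within b w v → Within (a + b) u v
  within-trans {a} {zero} h h′ rewrite within-0⇒≡ h′ | +-identityʳ a = h
  within-trans {a} {suc b} h h′ rewrite +-suc a b with within-suc⁻ h′
  ... | inj₁ h″            = within-suc (within-trans h h″)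
  ... | inj₂ (x , h″ , xv) = within-snoc (within-trans h h″) xv

  within-sym : ∀ {k u v} → Within k u v → Within k v u
  within-sym {zero} h rewrite within-0⇒≡ h = within-refl _
  within-sym {suc k} h with within-suc⁻ h
  ... | inj₁ h′            = within-suc (within-sym h′)
  ... | inj₂ (w , h′ , wv) = within-trans (within-adj (trans (Graph.sym G _ _) wv)) (within-sym h′)

  record Dist (u v : Fin n) (j : ℕ) : Set where
    field
      path  : Within j u v
      least : ∀ {k} → Within k u v → j ≤ k
  open Dist public

  dist-exists : ∀ {e u v} → Within e u v → ∃ λ j → j ≤ e × Dist u v j
  dist-exists {zero} h = 0 , z≤n , record { path = h ; least = λ _ → z≤n }
  dist-exists {suc e} {u} {v} h with within? e u v
  ... | yes h′ = let j , j≤e , d = dist-exists h′ in j , m≤n⇒m≤1+n j≤e , d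
  ... | no ¬h′ = suc e , ≤-refl , record { path = h ; least = least′ }
    where
    least′ : ∀ {k} → Within k u v → suc e ≤ k
    least′ {k} hk with suc e ≤? k
    ... | yes 1+e≤k = 1+e≤k
    ... | no 1+e≰k  = contradiction (within-mono (s≤s⁻¹ (≰⇒> 1+e≰k)) hk) ¬h′

  dist-pred : ∀ {u v j} → Dist u v (suc j) → ∃ λ w → Dist u w j × adj G w v ≡ true
  dist-pred d with within-suc⁻ (path d)
  ... | inj₁ h = contradiction (least d h) (1+n≰n)
  ... | inj₂ (w , h , wv) =
    w , record { path = h ; least = λ hk → s≤s⁻¹ (least d (within-snoc hk wv)) } , wv

  ancestor : ∀ i d {u v} → Dist u v (i + d) → ∃ λ y → Dist u y i × Within d y v
  ancestor i zero {v = v} dv rewrite +-identityʳ i = v , dv , within-refl v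
  ancestor i (suc d) dv rewrite +-suc i d with dist-pred dv
  ... | w , dw , wv with ancestor i d dw
  ...   | y , dy , yw = y , dy , within-snoc yw wv

  atDist⇒Dist : ∀ {u v} j → atDist G u j v ≡ true → Dist u v j
  atDist⇒Dist zero e = record { path = within e ; least = λ _ → z≤n }
  atDist⇒Dist {u} {v} (suc j) e with ∧-true⁻ {reach G (suc j) u v} e
  ... | uv , ¬uv = record { path = within uv ; least = least′ }
    where
    least′ : ∀ {k} → Within k u v → suc j ≤ k
    least′ {k} hk with suc j ≤? k
    ... | yes 1+j≤k = 1+j≤k
    ... | no 1+j≰k
      with () ← trans (sym (cong not (reached (within-mono (s≤s⁻¹ (≰⇒> 1+j≰k)) hk)))) ¬uv

  Dist⇒atDist : ∀ {u v} j → Dist u v j → atDist G u j v ≡ true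
  Dist⇒atDist zero d = reached (path d)
  Dist⇒atDist {u} {v} (suc j) d rewrite reached (path d) with reach G j u v in e
  ... | true  = contradiction (least d (within e)) 1+n≰n
  ... | false = refl

  dist? : ∀ u v j → Dec (Dist u v j)
  dist? u v j = map′ (atDist⇒Dist j) (Dist⇒atDist j) (atDist G u j v ≟ᵇ true)

  eccentricity-exists : ∀ {e z} → (∀ x → Within e z x) → ∃ λ s → s ≤ e × IsEccentricity G z s
  eccentricity-exists {zero} h = 0 , z≤n , reached ∘ h , λ _ _ → z≤n
  eccentricity-exists {suc e} {z} h with all? (within? e z)
  ... | yes h′ = let s , s≤e , ecc = eccentricity-exists h′ in s , m≤n⇒m≤1+n s≤e , ecc
  ... | no ¬h′ = suc e , ≤-refl , reached ∘ h , minimal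
    where
    minimal : ∀ k → (∀ x → reach G k z x ≡ true) → suc e ≤ k
    minimal k hk with suc e ≤? k
    ... | yes 1+e≤k = 1+e≤k
    ... | no 1+e≰k  = contradiction (λ x → within-mono (s≤s⁻¹ (≰⇒> 1+e≰k)) (within (hk x))) ¬h′

  eccentric-vertex : ∀ {v r} → IsEccentricity G v r → ∃ λ x → Dist v x r
  eccentric-vertex {v} {zero} _ = v , record { path = within-refl v ; least = λ _ → z≤n }
  eccentric-vertex {v} {suc r} (covers , minimal) with all? (within? r v)
  ... | yes all = contradiction (minimal r (reached ∘ all)) 1+n≰n
  ... | no ¬all with ¬∀⟶∃¬ n _ (within? r v) ¬all
  ...   | x , ¬vx with dist-exists (within (covers x))
  ...     | j , j≤1+r , dx with j ≤? r
  ...       | yes j≤r = contradiction (within-mono j≤r (path dx)) ¬vx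
  ...       | no j≰r  = x , subst (Dist v x) (≤-antisym j≤1+r (≰⇒> j≰r)) dx

  sumTo-distDeg : ∀ v m → sumTo (distDeg G v) m ≡ count (reach G m v)
  sumTo-distDeg v zero    = refl
  sumTo-distDeg v (suc m) = begin
    sumTo (distDeg G v) m + distDeg G v (suc m)        ≡⟨ cong (_+ distDeg G v (suc m)) (sumTo-distDeg v m) ⟩
    count (reach G m v) + count (atDist G v (suc m))   ≡⟨ count-∨-disjoint _ _ disjoint ⟨
    count (λ x → reach G m v x ∨ atDist G v (suc m) x) ≡⟨ count-cong split ⟩
    count (reach G (suc m) v)                          ∎
    where
    open ≡-Reasoning
    disjoint : ∀ x → reach G m v x ≡ true → atDist G v (suc m) x ≡ true → ⊥
    disjoint x h h′ = contradiction (least (atDist⇒Dist (suc m) h′) (within h)) 1+n≰n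
    split : ∀ x → reach G m v x ∨ atDist G v (suc m) x ≡ reach G (suc m) v x
    split x with reach G m v x
    ... | true  = refl
    ... | false = ∧-identityʳ _

module SecondNeighbourhood {n : ℕ} (G : Graph n) (c4 : C4Free G) where
  open Reachability G

  adj⇒≢ : ∀ {a b} → adj G a b ≡ true → a ≢ b
  adj⇒≢ {a} ab refl = contradiction (trans (sym ab) (irrefl G a)) λ ()

  adj-sym : ∀ {a b} → adj G a b ≡ true → adj G b a ≡ true
  adj-sym {a} {b} ab = trans (Graph.sym G b a) ab

  common-neighbour-unique : ∀ {p q x y} → p ≢ q → adj G p x ≡ true → adj G x q ≡ true →
                            adj G p y ≡ true → adj G y q ≡ true → x ≡ y
  common-neighbour-unique {p} {q} {x} {y} p≢q px xq py yq with x ≟ y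
  ... | yes x≡y = x≡y
  ... | no x≢y  = contradiction (px , xq , adj-sym yq , adj-sym py)
                    (c4 p x q y (adj⇒≢ px) p≢q (adj⇒≢ py) (adj⇒≢ xq) x≢y (adj⇒≢ yq ∘ sym))

  module _ (u : Fin n) where
    N : Fin n → Bool
    N = adj G u

    Far : Fin n → Bool
    Far x = not ⌊ u ≟ x ⌋ ∧ not (N x)

    Inner : Fin n → Fin n → Bool
    Inner w y = (N w ∧ N y) ∧ adj G w y

    Out : Fin n → Fin n → Bool
    Out w x = N w ∧ (adj G w x ∧ Far x)

    Second : Fin n → Bool
    Second x = anyFin (λ w → Out w x)

    degree-≤ : ∀ {w} → N w ≡ true → degree G w ≤ 1 + (count (Inner w) + count (Out w))
    degree-≤ {w} uw = begin
      count (adj G w)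
        ≤⟨ count-mono covered ⟩
      count (λ x → (⌊ u ≟ x ⌋ ∨ Inner w x) ∨ Out w x)
        ≤⟨ count-∨-≤ (λ x → ⌊ u ≟ x ⌋ ∨ Inner w x) (Out w) ⟩
      count (λ x → ⌊ u ≟ x ⌋ ∨ Inner w x) + count (Out w)
        ≤⟨ +-monoˡ-≤ _ (count-∨-≤ (λ x → ⌊ u ≟ x ⌋) (Inner w)) ⟩
      count (λ x → ⌊ u ≟ x ⌋) + count (Inner w) + count (Out w)
        ≡⟨ +-assoc (count (λ x → ⌊ u ≟ x ⌋)) (count (Inner w)) (count (Out w)) ⟩
      count (λ x → ⌊ u ≟ x ⌋) + (count (Inner w) + count (Out w))
        ≡⟨ cong (_+ (count (Inner w) + count (Out w))) (count-singleton u) ⟩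
      1 + (count (Inner w) + count (Out w)) ∎
      where
      open ≤-Reasoning
      covered : ∀ x → adj G w x ≡ true → (⌊ u ≟ x ⌋ ∨ Inner w x) ∨ Out w x ≡ true
      covered x wx rewrite uw | wx with ⌊ u ≟ x ⌋ | N x
      ... | true  | _     = refl
      ... | false | true  = refl
      ... | false | false = refl

    inner⁻ : ∀ {w y} → Inner w y ≡ true → N w ≡ true × N y ≡ true × adj G w y ≡ true
    inner⁻ {w} h with ∧-true⁻ {N w ∧ _} h
    ... | h′ , wy with ∧-true⁻ {N w} h′
    ...   | uw , uy = uw , uy , wy

    out⁻ : ∀ {w x} → Out w x ≡ true → N w ≡ true × adj G w x ≡ true × Far x ≡ true
    out⁻ {w} {x} h with ∧-true⁻ {N w} h
    ... | uw , h′ with ∧-true⁻ {adj G w x} h′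
    ...   | wx , far = uw , wx , far

    far⁻ : ∀ {x} → Far x ≡ true → u ≢ x × N x ≡ false
    far⁻ {x} h with ∧-true⁻ {not ⌊ u ≟ x ⌋} h
    ... | u≠x , ¬ux = ⌊≟⌋⇒≢ (not-injective u≠x) , not-injective ¬ux

    second⇒far : ∀ {x} → Second x ≡ true → Far x ≡ true
    second⇒far {x} h with anyFin-elim (λ w → Out w x) h
    ... | _ , out = let _ , _ , far = out⁻ out in far

    inner-≤ : ∀ w → count (Inner w) ≤ χ (N w)
    inner-≤ w = ≤-trans (count-≤-χ-any (Inner w) unique) (χ-mono inner⇒N)
      where
      inner⇒N : anyFin (Inner w) ≡ true → N w ≡ true
      inner⇒N h with anyFin-elim (Inner w) h
      ... | _ , inner = let uw , _ , _ = inner⁻ inner in uw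
      unique : Unique (Inner w)
      unique y y′ hy hy′ with inner⁻ hy | inner⁻ hy′
      ... | uw , uy , wy | _ , uy′ , wy′ =
        common-neighbour-unique (adj⇒≢ uw) uy (adj-sym wy) uy′ (adj-sym wy′)

    out-column-≤ : ∀ x → count (λ w → Out w x) ≤ χ (Second x)
    out-column-≤ x = count-≤-χ-any (λ w → Out w x) unique
      where
      unique : Unique (λ w → Out w x)
      unique w w′ hw hw′ with out⁻ hw | out⁻ hw′
      ... | uw , wx , far | uw′ , w′x , _ = common-neighbour-unique (proj₁ (far⁻ far)) uw wx uw′ w′x

    inner-pairs-≤ : ∑[ w < n ] count (Inner w) ≤ count N
    inner-pairs-≤ = ≤-trans (∑-mono-≤ inner-≤) (≤-reflexive (sym (count≡∑ N)))

    inner-pairs-even : 2 ∣ ∑[ w < n ] count (Inner w)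
    inner-pairs-even =
      subst (2 ∣_) (sum-cong-≗ (λ w → sym (count≡∑ (Inner w))))
            (handshake (λ w y → χ (Inner w y)) (λ w y → cong χ (inner-sym w y))
                       (λ w → cong χ (inner-irrefl w)))
      where
      inner-sym : ∀ w y → Inner w y ≡ Inner y w
      inner-sym w y = cong₂ _∧_ (∧-comm (N w) (N y)) (Graph.sym G w y)
      inner-irrefl : ∀ w → Inner w w ≡ false
      inner-irrefl w = trans (cong ((N w ∧ N w) ∧_) (irrefl G w)) (∧-zeroʳ _)

    out-pairs-≤ : ∑[ w < n ] count (Out w) ≤ count Second
    out-pairs-≤ = begin
      ∑[ w < n ] count (Out w)              ≡⟨ sum-cong-≗ (λ w → count≡∑ (Out w)) ⟩
      ∑[ w < n ] ∑[ x < n ] χ (Out w x)     ≡⟨ ∑-comm (λ w x → χ (Out w x)) ⟩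
      ∑[ x < n ] ∑[ w < n ] χ (Out w x)     ≡⟨ sum-cong-≗ (λ x → count≡∑ (λ w → Out w x)) ⟨
      ∑[ x < n ] count (λ w → Out w x)      ≤⟨ ∑-mono-≤ out-column-≤ ⟩
      ∑[ x < n ] χ (Second x)               ≡⟨ count≡∑ Second ⟨
      count Second                          ∎
      where open ≤-Reasoning

    degree-sum : ∀ {δ} → (∀ v → δ ≤ degree G v) →
                 count N * δ ≤ count N + (∑[ w < n ] count (Inner w) + ∑[ w < n ] count (Out w))
    degree-sum {δ} mindeg = begin
      count N * δ                                              ≡⟨ cong (_* δ) (count≡∑ N) ⟩
      (∑[ w < n ] χ (N w)) * δ                                  ≡⟨ *-distribʳ-sum δ (χ ∘ N) ⟩
      ∑[ w < n ] (χ (N w) * δ)                                  ≤⟨ ∑-mono-≤ per-neighbour ⟩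
      ∑[ w < n ] (χ (N w) + (count (Inner w) + count (Out w)))  ≡⟨ ∑-distrib-+ (χ ∘ N) _ ⟩
      ∑[ w < n ] χ (N w) + ∑[ w < n ] (count (Inner w) + count (Out w))
        ≡⟨ cong₂ _+_ (sym (count≡∑ N)) (∑-distrib-+ (count ∘ Inner) (count ∘ Out)) ⟩
      count N + (∑[ w < n ] count (Inner w) + ∑[ w < n ] count (Out w)) ∎
      where
      open ≤-Reasoning
      per-neighbour : ∀ w → χ (N w) * δ ≤ χ (N w) + (count (Inner w) + count (Out w))
      per-neighbour w = χ*≤χ+ (N w) (λ uw → ≤-trans (mindeg w) (degree-≤ uw))

    ball-≥ : suc (count N + count Second) ≤ count (reach G 2 u)
    ball-≥ = begin
      suc (count N + count Second)
        ≡⟨ cong₂ _+_ (count-singleton u) (count-∨-disjoint N Second N-Second-disjoint) ⟨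
      count (λ x → ⌊ u ≟ x ⌋) + count (λ x → N x ∨ Second x)
        ≡⟨ count-∨-disjoint _ _ centre-disjoint ⟨
      count (λ x → ⌊ u ≟ x ⌋ ∨ (N x ∨ Second x))
        ≤⟨ count-mono covered ⟩
      count (reach G 2 u) ∎
      where
      open ≤-Reasoning
      N-Second-disjoint : ∀ x → N x ≡ true → Second x ≡ true → ⊥
      N-Second-disjoint x ux sx = contradiction (trans (sym ux) (proj₂ (far⁻ (second⇒far sx)))) λ ()
      centre-disjoint : ∀ x → ⌊ u ≟ x ⌋ ≡ true → N x ∨ Second x ≡ true → ⊥
      centre-disjoint x u≡x h with ⌊≟⌋⇒≡ u≡x
      ... | refl with ∨-true⁻ {N u} h
      ...   | inj₁ uu = contradiction (trans (sym uu) (irrefl G u)) λ ()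
      ...   | inj₂ su = proj₁ (far⁻ (second⇒far su)) refl
      covered : ∀ x → ⌊ u ≟ x ⌋ ∨ (N x ∨ Second x) ≡ true → reach G 2 u x ≡ true
      covered x h with ∨-true⁻ {⌊ u ≟ x ⌋} h
      ... | inj₁ u≡x = reached (within-mono {0} {2} z≤n (within u≡x))
      ... | inj₂ h′ with ∨-true⁻ {N x} h′
      ...   | inj₁ ux = reached (within-mono {1} {2} (s≤s z≤n) (within-adj ux))
      ...   | inj₂ sx with anyFin-elim (λ w → Out w x) sx
      ...     | w , out = let uw , wx , _ = out⁻ out in reached (within-snoc {1} (within-adj uw) wx)

  ball-bound : ∀ {δ} → (∀ v → δ ≤ degree G v) → ∀ u → deltaStar δ ≤ count (reach G 2 u)
  ball-bound mindeg u =
    deltaStar-≤ (mindeg u) (inner-pairs-≤ u) (inner-pairs-even u) (degree-sum u mindeg)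
                (≤-trans (s≤s (+-monoʳ-≤ (count (N u)) (out-pairs-≤ u))) (ball-≥ u))

module Window {n : ℕ} (G : Graph n) (v₀ : Fin n) where
  open Reachability G

  layer : ℤ → Fin n → Bool
  layer (ℤ.+ j)    = atDist G v₀ j
  layer -[1+ _ ] = λ _ → false

  count-layer : ∀ z → count (layer z) ≡ distDegℤ G v₀ z
  count-layer (ℤ.+ j)    = refl
  count-layer -[1+ _ ] = count-all-false {n} λ _ → refl

  below₂ below₁ at above₁ above₂ : ℕ → Fin n → Bool
  below₂ i = layer (ℤ.+ i ℤ.- ℤ.+ 2)
  below₁ i = layer (ℤ.+ i ℤ.- ℤ.+ 1)
  at     i = layer (ℤ.+ i)
  above₁ i = layer (ℤ.+ (i + 1))
  above₂ i = layer (ℤ.+ (i + 2))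

  inWindow : ℕ → Fin n → Bool
  inWindow i x = (((below₂ i x ∨ below₁ i x) ∨ at i x) ∨ above₁ i x) ∨ above₂ i x

  count-inWindow : ∀ i → count (inWindow i) ≤ window5 G v₀ i
  count-inWindow i = begin
    count (inWindow i)
      ≤⟨ count-∨-≤ _ (above₂ i) ⟩
    count (λ x → ((below₂ i x ∨ below₁ i x) ∨ at i x) ∨ above₁ i x) + count (above₂ i)
      ≤⟨ +-monoˡ-≤ _ (≤-trans (count-∨-≤ _ (above₁ i))
           (+-monoˡ-≤ _ (≤-trans (count-∨-≤ _ (at i)) (+-monoˡ-≤ _ (count-∨-≤ (below₂ i) (below₁ i)))))) ⟩
    count (below₂ i) + count (below₁ i) + count (at i) + count (above₁ i) + count (above₂ i)
      ≡⟨ cong₂ (λ a b → a + b + distDeg G v₀ i + distDeg G v₀ (i + 1) + distDeg G v₀ (i + 2))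
               (count-layer (ℤ.+ i ℤ.- ℤ.+ 2)) (count-layer (ℤ.+ i ℤ.- ℤ.+ 1)) ⟩
    window5 G v₀ i ∎
    where open ≤-Reasoning

  private
    +[j+k]-k : ∀ j k → ℤ.+ (j + k) ℤ.- ℤ.+ k ≡ ℤ.+ j
    +[j+k]-k j k = begin
      ℤ.+ (j + k) ℤ.- ℤ.+ k ≡⟨ m-n≡m⊖n (j + k) k ⟩
      (j + k) ⊖ k           ≡⟨ cong₂ _⊖_ (+-comm k j) (+-identityʳ k) ⟨
      (k + j) ⊖ (k + 0)     ≡⟨ +-cancelˡ-⊖ k j 0 ⟩
      ℤ.+ j                 ∎
      where open ≡-Reasoning

    near : ∀ i j → i ≤ j + 2 → j ≤ i + 2 →
           i ≡ j + 2 ⊎ i ≡ j + 1 ⊎ j ≡ i ⊎ j ≡ i + 1 ⊎ j ≡ i + 2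
    near zero                zero                _              _ = inj₂ (inj₂ (inj₁ refl))
    near zero                (suc zero)          _              _ = inj₂ (inj₂ (inj₂ (inj₁ refl)))
    near zero                (suc (suc zero))    _              _ = inj₂ (inj₂ (inj₂ (inj₂ refl)))
    near zero                (suc (suc (suc _))) _ (s≤s (s≤s ()))
    near (suc zero)          zero                _              _ = inj₂ (inj₁ refl)
    near (suc (suc zero))    zero                _              _ = inj₁ refl
    near (suc (suc (suc _))) zero   (s≤s (s≤s ()))              _
    near (suc i) (suc j) i≤j+2 j≤i+2 with near i j (s≤s⁻¹ i≤j+2) (s≤s⁻¹ j≤i+2)
    ... | inj₁ e                      = inj₁ (cong suc e)
    ... | inj₂ (inj₁ e)               = inj₂ (inj₁ (cong suc e))
    ... | inj₂ (inj₂ (inj₁ e))        = inj₂ (inj₂ (inj₁ (cong suc e)))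
    ... | inj₂ (inj₂ (inj₂ (inj₁ e))) = inj₂ (inj₂ (inj₂ (inj₁ (cong suc e))))
    ... | inj₂ (inj₂ (inj₂ (inj₂ e))) = inj₂ (inj₂ (inj₂ (inj₂ (cong suc e))))

  inWindow-intro : ∀ {i j x} → Dist v₀ x j → i ≤ j + 2 → j ≤ i + 2 → inWindow i x ≡ true
  inWindow-intro {i} {j} {x} dx i≤j+2 j≤i+2 with near i j i≤j+2 j≤i+2
  ... | inj₁ refl =
    ∨-introˡ (above₂ i x) (∨-introˡ (above₁ i x) (∨-introˡ (at i x) (∨-introˡ (below₁ i x)
      (subst (λ z → layer z x ≡ true) (sym (+[j+k]-k j 2)) (Dist⇒atDist j dx)))))
  ... | inj₂ (inj₁ refl) =
    ∨-introˡ (above₂ i x) (∨-introˡ (above₁ i x) (∨-introˡ (at i x) (∨-introʳ (below₂ i x)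
      (subst (λ z → layer z x ≡ true) (sym (+[j+k]-k j 1)) (Dist⇒atDist j dx)))))
  ... | inj₂ (inj₂ (inj₁ refl)) =
    ∨-introˡ (above₂ i x) (∨-introˡ (above₁ i x)
      (∨-introʳ (below₂ i x ∨ below₁ i x) (Dist⇒atDist j dx)))
  ... | inj₂ (inj₂ (inj₂ (inj₁ refl))) =
    ∨-introˡ (above₂ i x) (∨-introʳ ((below₂ i x ∨ below₁ i x) ∨ at i x) (Dist⇒atDist j dx))
  ... | inj₂ (inj₂ (inj₂ (inj₂ refl))) =
    ∨-introʳ (((below₂ i x ∨ below₁ i x) ∨ at i x) ∨ above₁ i x) (Dist⇒atDist j dx)

  count-≤-window5 : ∀ {i} (p : Fin n → Bool) →
                    (∀ x → p x ≡ true → ∃ λ u → Dist v₀ u i × Within 2 u x) →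
                    count p ≤ window5 G v₀ i
  count-≤-window5 {i} p near-layer = ≤-trans (count-mono in-window) (count-inWindow i)
    where
    in-window : ∀ x → p x ≡ true → inWindow i x ≡ true
    in-window x px with near-layer x px
    ... | u , du , ux with dist-exists (within-trans (path du) ux)
    ...   | j , j≤i+2 , dx = inWindow-intro dx (least du (within-trans (path dx) (within-sym ux))) j≤i+2

module Centre {n : ℕ} (G : Graph n) (v₀ : Fin n) (r : ℕ) (centre : IsCentre G v₀ r) where
  open Reachability G
  open Window G v₀
  open SecondNeighbourhood G

  within-radius : ∀ x → Within r v₀ x
  within-radius x = within (proj₁ (proj₁ centre) x)

  radius-≤ : ∀ {z e} → (∀ x → Within e z x) → r ≤ e
  radius-≤ {z} h with eccentricity-exists h
  ... | s , s≤e , ecc = ≤-trans (proj₂ centre z s ecc) s≤e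

  layer-nonempty : ∀ {i} → i ≤ r → ∃ λ y → Dist v₀ y i
  layer-nonempty {i} i≤r with eccentric-vertex (proj₁ centre)
  ... | x , dx with ancestor i (r ∸ i) (subst (Dist v₀ x) (sym (m+[n∸m]≡n i≤r)) dx)
  ...   | y , dy , _ = y , dy

  no-shortcut : ∀ {a i z} → Within a v₀ z → a + suc i ≤ r →
                ¬ (∀ y → Dist v₀ y (suc i) → Within i z y)
  no-shortcut {a} {i} {z} v₀z a+1+i≤r cover =
    contradiction (m≤pred[n]⇒suc[m]≤n {{>-nonZero 0<r}} (radius-≤ within-pred-radius)) 1+n≰n
    where
    0<r : 0 < r
    0<r = ≤-trans (s≤s z≤n) (m+n≤o⇒n≤o a a+1+i≤r)
    within-pred-radius : ∀ x → Within (pred r) z x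
    within-pred-radius x with dist-exists (within-radius x)
    ... | j , j≤r , dx with j ≤? i
    ...   | yes j≤i =
      within-mono (≤-trans (+-monoʳ-≤ a j≤i) a+i≤pred-r) (within-trans (within-sym v₀z) (path dx))
      where
      a+i≤pred-r : a + i ≤ pred r
      a+i≤pred-r = suc[m]≤n⇒m≤pred[n] (subst (_≤ r) (+-suc a i) a+1+i≤r)
    ...   | no j≰i with m≤n⇒∃[o]m+o≡n (≰⇒> j≰i)
    ...     | d , refl with ancestor (suc i) d dx
    ...       | y , dy , yx = within-mono (suc[m]≤n⇒m≤pred[n] j≤r) (within-trans (cover y dy) yx)

  sumTo-distDeg-radius : ∀ m → r ≤ m → sumTo (distDeg G v₀) m ≡ n
  sumTo-distDeg-radius m r≤m =
    trans (sumTo-distDeg v₀ m) (count-all-true (λ x → reached (within-mono r≤m (within-radius x))))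

  distDeg-≥2 : ∀ i → 1 ≤ i → i + 1 ≤ r → 2 ≤ distDeg G v₀ i
  distDeg-≥2 (suc i) _ i+2≤r with 2 ≤? distDeg G v₀ (suc i)
  ... | yes 2≤nᵢ = 2≤nᵢ
  ... | no 2≰nᵢ with layer-nonempty (m+n≤o⇒m≤o (suc i) i+2≤r)
  ...   | c , dc with ancestor 1 i dc
  ...     | z , dz , zc = contradiction cover (no-shortcut (path dz) (subst (_≤ r) (+-comm (suc i) 1) i+2≤r))
    where
    cover : ∀ y → Dist v₀ y (suc i) → Within i z y
    cover y dy with y ≟ c
    ... | yes refl = zc
    ... | no y≢c   =
      contradiction (count-pair (atDist G v₀ (suc i)) y≢c (Dist⇒atDist _ dy) (Dist⇒atDist _ dc)) 2≰nᵢ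

  window5-≥-deltaStar : ∀ {δ} → C4Free G → (∀ v → δ ≤ degree G v) →
                        ∀ i → i ≤ r → deltaStar δ ≤ window5 G v₀ i
  window5-≥-deltaStar c4 mindeg i i≤r with layer-nonempty i≤r
  ... | u , du =
    ≤-trans (ball-bound c4 mindeg u) (count-≤-window5 (reach G 2 u) λ x ux → u , du , within {2} {u} {x} ux)

  window5-≥-two-balls : ∀ {δ i u w} → C4Free G → (∀ v → δ ≤ degree G v) →
                        Dist v₀ u i → Dist v₀ w i → ¬ Within 4 u w →
                        2 * deltaStar δ ≤ window5 G v₀ i
  window5-≥-two-balls {δ} {i} {u} {w} c4 mindeg du dw ¬uw = begin
    2 * deltaStar δ                             ≡⟨ cong (_+_ (deltaStar δ)) (+-identityʳ (deltaStar δ)) ⟩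
    deltaStar δ + deltaStar δ                   ≤⟨ +-mono-≤ (ball-bound c4 mindeg u) (ball-bound c4 mindeg w) ⟩
    count (reach G 2 u) + count (reach G 2 w)   ≡⟨ count-∨-disjoint (reach G 2 u) (reach G 2 w) disjoint ⟨
    count (λ x → reach G 2 u x ∨ reach G 2 w x) ≤⟨ count-≤-window5 _ in-balls ⟩
    window5 G v₀ i                              ∎
    where
    open ≤-Reasoning
    disjoint : ∀ x → reach G 2 u x ≡ true → reach G 2 w x ≡ true → ⊥
    disjoint x ux wx = ¬uw (within-trans (within {2} {u} {x} ux) (within-sym (within {2} {w} {x} wx)))
    in-balls : ∀ x → reach G 2 u x ∨ reach G 2 w x ≡ true → ∃ λ v → Dist v₀ v i × Within 2 v x
    in-balls x h with ∨-true⁻ {reach G 2 u x} h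
    ... | inj₁ ux = u , du , within {2} {u} {x} ux
    ... | inj₂ wx = w , dw , within {2} {w} {x} wx

  window5-≥-2deltaStar : ∀ {δ} → C4Free G → (∀ v → δ ≤ degree G v) →
                         ∀ i → 10 ≤ i → i + 9 ≤ r → 2 * deltaStar δ ≤ window5 G v₀ i
  window5-≥-2deltaStar c4 mindeg i 10≤i i+9≤r with m≤n⇒∃[o]m+o≡n (m+n≤o⇒m≤o 5 10≤i)
  ... | k , refl with layer-nonempty (m+n≤o⇒m≤o (5 + k) i+9≤r)
  ...   | u , du with any? (λ w → dist? v₀ w (5 + k) ×-dec ¬? (within? 4 u w))
  ...     | yes (w , dw , ¬uw) = window5-≥-two-balls c4 mindeg du dw ¬uw
  ...     | no all-near with ancestor 5 k du
  ...       | z , dz , zu = contradiction cover (no-shortcut (path dz) 5+[5+k]≤r)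
    where
    cover : ∀ y → Dist v₀ y (5 + k) → Within (4 + k) z y
    cover y dy = subst (λ e → Within e z y) (+-comm k 4)
                   (within-trans zu (decidable-stable (within? 4 u y) λ ¬uy → all-near (y , dy , ¬uy)))
    5+[5+k]≤r : 5 + (5 + k) ≤ r
    5+[5+k]≤r = m+n≤o⇒m≤o (5 + (5 + k)) (subst (_≤ r) (shift k) i+9≤r)
      where
      shift : ∀ k → 5 + k + 9 ≡ 5 + (5 + k) + 4
      shift = solve-∀

-- Connectedness follows from v₀ having an eccentricity, and (D4), (D5) hold for every i.
proposition6p1 : ∀ (n : ℕ) (G : Graph n) (δ : ℕ) (v₀ : Fin n) (r : ℕ) →
    Connected G → C4Free G → IsMinDegree G δ → IsCentre G v₀ r →
    (distDeg G v₀ 0 ≡ 1) ×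
    (∀ m → r ≤ m → sumTo (distDeg G v₀) m ≡ n) ×
    (∀ i → 1 ≤ i → i + 1 ≤ r → 2 ≤ distDeg G v₀ i) ×
    (∀ i → i ≤ r → i % 5 ≡ 0 → deltaStar δ ≤ window5 G v₀ i) ×
    (∀ i → 10 ≤ i → i + 9 ≤ r → i % 5 ≡ 0 → 2 * deltaStar δ ≤ window5 G v₀ i)
proposition6p1 n G δ v₀ r _ c4 (mindeg , _) centre =
  count-singleton v₀ ,
  sumTo-distDeg-radius ,
  distDeg-≥2 ,
  (λ i i≤r _ → window5-≥-deltaStar c4 mindeg i i≤r) ,
  (λ i 10≤i i+9≤r _ → window5-≥-2deltaStar c4 mindeg i 10≤i i+9≤r)
  where open Centre G v₀ r centre
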